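{- Let $A$ be a set of $k$ nonnegative integers with $0\in A$. Let $H=\{h_{1},h_{2},\ldots,h_{r}\}$ be a set of positive integers with $h_{1}<h_{2}<\cdots<h_{r}\leq k-1$. Set $h_{0}=0$. Then \[ |H\,\hat{}A| \geq \sum_{i=1}^{r}(h_{i}-h_{i-1})(k-h_{i}-1)+h_{1}+r. \] This lower bound is optimal: for positive integers $k,r$ with $r\le k-1$, taking $A=[0,k-1]$ and $H=[1,r]$ gives equality.
   Context: For a positive integer $h$ and a finite set $A$ of integers, $h\,\hat{}A$ denotes the set of all integers expressible as a sum of $h$ pairwise distinct elements of $A$. For a finite set $H$ of positive integers, $H\,\hat{}A := \bigcup_{h\in H} h\,\hat{}A$. For integers $a\le b$, $[a,b]=\{a,a+1,\ldots,b\}$. -}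

module Defs where

open import Data.Nat using (ℕ; zero; suc; _+_; _*_; _∸_; _≟_)
open import Data.List using (List; []; _∷_; _++_; map; length; filter; concatMap; deduplicate)
open import Data.Nat.ListAction using (sum)
open import Relation.Binary.PropositionalEquality using (_≡_)
open import Data.Nat using (_≟_)

-- All sub-lists (sub-multisets by position) of a list; for a duplicate-free
-- list these are exactly its subsets.
subsets : List ℕ → List (List ℕ)
subsets []       = [] ∷ []
subsets (x ∷ xs) = subsets xs ++ map (x ∷_) (subsets xs)

-- h^A as a list (with repetitions): sums of h pairwise distinct elements of A
-- (A is assumed duplicate-free, so distinct positions = distinct elements).
restrictedSums : ℕ → List ℕ → List ℕ
restrictedSums h A = map sum (filter (λ S → length S ≟ h) (subsets A))

HSums : List ℕ → List ℕ → List ℕ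
HSums H A = concatMap (λ h → restrictedSums h A) H

card-HSums : List ℕ → List ℕ → ℕ
card-HSums H A = length (deduplicate _≟_ (HSums H A))

stepSum : ℕ → ℕ → List ℕ → ℕ
stepSum k prev []       = 0
stepSum k prev (h ∷ hs) = (h ∸ prev) * (k ∸ h ∸ 1) + stepSum k h hs

bound : ℕ → List ℕ → ℕ
bound k []         = 0
bound k (h₁ ∷ hs)  = stepSum k 0 (h₁ ∷ hs) + h₁ + length (h₁ ∷ hs)

-- Remove 0 from A and list the rest as b₁ > ⋯ > b_m > 0 (m = k − 1), with prefix sums
-- s_j = b₁ + ⋯ + b_j.  The h₁-sums of b₁ > ⋯ > b_m > 0 take at least h₁(k − h₁) + 1
-- distinct values, all ≤ s_{h₁}.  For i ≥ 2, s_{h_{i−1}} plus the (h_i − h_{i−1})-sums of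
-- b_{h_{i−1}+1} > ⋯ > b_m gives (h_i − h_{i−1})(k − h_i − 1) + 1 distinct h_i-sums in
-- (s_{h_{i−1}}, s_{h_i}].  These blocks are disjoint and their sizes add up to the bound.
-- A strictly decreasing list c ∷ C of length n has at least d(n − d) + 1 distinct d-sums:
-- those of C, all ≤ the sum t of its d largest entries, and the d values c + t − b for b
-- one of those entries, all > t.  For A = [0, k − 1] and H = [1, r], H^A lies in
-- [0, (k − 1) + ⋯ + (k − r)], an interval whose size is the bound.
module Submission where

open import Data.Empty using (⊥-elim)
open import Data.List
  using (List; []; _∷_; _++_; [_]; map; length; take; drop; deduplicate; upTo; downFrom; applyUpTo)
open import Data.List.Membership.Propositional using (_∈_; find)
open import Data.List.Membership.Propositional.Properties
  using (∈-++⁺ˡ; ∈-++⁺ʳ; ∈-++⁻; ∈-map⁺; ∈-map⁻; ∈-∃++; ∈-filter⁺; ∈-filter⁻; ∈-concat⁺; ∈-concat⁻;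
         ∈-deduplicate⁺; ∈-deduplicate⁻; ∈-upTo⁺; ∈-upTo⁻)
open import Data.List.Properties
  using (length-++; length-++-comm; length-map; length-drop; length-take; length-upTo; map-upTo;
         map-applyUpTo; take++drop≡id; take-[]; reverse-upTo)
open import Data.List.Relation.Binary.Permutation.Propositional
  using (_↭_; refl; prep; swap; trans; ↭-sym; ↭⇒↭ₛ)
open import Data.List.Relation.Binary.Permutation.Propositional.Properties
  using (All-resp-↭; ↭-length; ↭-reverse; shift; ∷↭∷ʳ)
import Data.List.Relation.Binary.Permutation.Setoid.Properties as Permutationₛ
open import Data.List.Relation.Binary.Sublist.Propositional
  using (_⊆_; []; _∷_; _∷ʳ_; ⊆-refl; ⊆-trans)
open import Data.List.Relation.Binary.Sublist.Propositional.Properties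
  using (++⁺; ++⁺ʳ; take-⊆; take⁺; All-resp-⊆)
open import Data.List.Relation.Unary.All using (All; []; _∷_)
import Data.List.Relation.Unary.All as All
import Data.List.Relation.Unary.All.Properties as All
open import Data.List.Relation.Unary.AllPairs using (AllPairs; []; _∷_)
import Data.List.Relation.Unary.AllPairs as AllPairs
import Data.List.Relation.Unary.AllPairs.Properties as AllPairs
open import Data.List.Relation.Unary.Any using (Any; here; there)
import Data.List.Relation.Unary.Any as Any
import Data.List.Relation.Unary.Any.Properties as Any
open import Data.List.Relation.Unary.Linked using (Linked; [-]; _∷_)
import Data.List.Relation.Unary.Linked as Linked
import Data.List.Relation.Unary.Linked.Properties as Linked
open import Data.List.Relation.Unary.Unique.Propositional using (Unique)
import Data.List.Relation.Unary.Unique.Propositional.Properties as Unique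
open import Data.List.Relation.Unary.Unique.DecPropositional.Properties using (deduplicate-!)
open import Data.Nat using (ℕ; zero; suc; _+_; _*_; _∸_; _≤_; _<_; _≥_; _>_; z≤n; s≤s; _≟_; _≤?_)
open import Data.Nat.ListAction using (sum)
open import Data.Nat.ListAction.Properties using (sum-++; sum-↭)
open import Data.Nat.Properties
open import Data.Nat.Tactic.RingSolver using (solve-∀)
open import Data.Product using (_×_; _,_; ∃-syntax)
open import Data.Sum using (inj₁; inj₂)
open import Function using (_∘_)
open import Level using (Level)
open import Relation.Binary.PropositionalEquality
  using (_≡_; _≢_; refl; sym; cong; cong₂; subst; subst₂; setoid; module ≡-Reasoning)
import Relation.Binary.PropositionalEquality as ≡
open import Relation.Nullary using (yes; no)

open import Relation.Binary.Properties.DecTotalOrder ≤-decTotalOrder using (≥-decTotalOrder)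
open import Data.List.Sort ≥-decTotalOrder using (sort; sort-↭; sort-↗)

open import Defs

private
  variable
    a : Level
    A : Set a

Unique-length-≤ : ∀ {xs : List A} ys → Unique xs → All (_∈ ys) xs → length xs ≤ length ys
Unique-length-≤ ys [] [] = z≤n
Unique-length-≤ {xs = x ∷ xs} ys (x∉xs ∷ u) (x∈ys ∷ xs⊆ys) with ∈-∃++ x∈ys
... | us , vs , refl = begin
  suc (length xs)             ≤⟨ s≤s (Unique-length-≤ (us ++ vs) u xs⊆us++vs) ⟩
  suc (length (us ++ vs))     ≡⟨ cong suc (length-++ us) ⟩
  suc (length us + length vs) ≡⟨ +-suc (length us) (length vs) ⟨
  length us + length (x ∷ vs) ≡⟨ length-++ us ⟨
  length (us ++ x ∷ vs)       ∎
  where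
  open ≤-Reasoning
  remove : ∀ {x y} → x ≢ y → y ∈ us ++ x ∷ vs → y ∈ us ++ vs
  remove x≢y y∈ with ∈-++⁻ us y∈
  ... | inj₁ y∈us         = ∈-++⁺ˡ y∈us
  ... | inj₂ (here y≡x)   = ⊥-elim (x≢y (sym y≡x))
  ... | inj₂ (there y∈vs) = ∈-++⁺ʳ us y∈vs
  xs⊆us++vs : All (_∈ us ++ vs) xs
  xs⊆us++vs = All.zipWith (λ (x≢y , y∈) → remove x≢y y∈) (x∉xs , xs⊆ys)

Unique-++-separated : ∀ {xs ys : List ℕ} b → Unique xs → Unique ys →
                      All (_≤ b) xs → All (b <_) ys → Unique (xs ++ ys)
Unique-++-separated b uxs uys xs≤b b<ys =
  Unique.++⁺ uxs uys (λ (x∈xs , x∈ys) → <⇒≱ (All.lookup b<ys x∈ys) (All.lookup xs≤b x∈xs))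

Unique-resp-↭ : ∀ {xs ys : List A} → xs ↭ ys → Unique xs → Unique ys
Unique-resp-↭ σ = Permutationₛ.Unique-resp-↭ (setoid _) (↭⇒↭ₛ σ)

sublist-resp-↭ : ∀ {xs ys zs : List A} → xs ↭ ys → zs ⊆ xs → ∃[ zs′ ] (zs′ ⊆ ys × zs′ ↭ zs)
sublist-resp-↭ {zs = zs} refl τ = zs , τ , refl
sublist-resp-↭ (prep x σ) (.x ∷ʳ τ) with sublist-resp-↭ σ τ
... | zs′ , τ′ , ρ = zs′ , x ∷ʳ τ′ , ρ
sublist-resp-↭ (prep x σ) (refl ∷ τ) with sublist-resp-↭ σ τ
... | zs′ , τ′ , ρ = x ∷ zs′ , refl ∷ τ′ , prep x ρ
sublist-resp-↭ (swap x y σ) (.x ∷ʳ .y ∷ʳ τ) with sublist-resp-↭ σ τ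
... | zs′ , τ′ , ρ = zs′ , y ∷ʳ x ∷ʳ τ′ , ρ
sublist-resp-↭ (swap x y σ) (.x ∷ʳ refl ∷ τ) with sublist-resp-↭ σ τ
... | zs′ , τ′ , ρ = y ∷ zs′ , refl ∷ x ∷ʳ τ′ , prep y ρ
sublist-resp-↭ (swap x y σ) (refl ∷ .y ∷ʳ τ) with sublist-resp-↭ σ τ
... | zs′ , τ′ , ρ = x ∷ zs′ , y ∷ʳ refl ∷ τ′ , prep x ρ
sublist-resp-↭ (swap x y σ) (refl ∷ refl ∷ τ) with sublist-resp-↭ σ τ
... | zs′ , τ′ , ρ = y ∷ x ∷ zs′ , refl ∷ refl ∷ τ′ , swap y x ρ
sublist-resp-↭ (trans σ₁ σ₂) τ with sublist-resp-↭ σ₁ τ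
... | zs₁ , τ₁ , ρ₁ with sublist-resp-↭ σ₂ τ₁
... | zs₂ , τ₂ , ρ₂ = zs₂ , τ₂ , trans ρ₂ ρ₁

take-+ : ∀ m n (xs : List A) → take (m + n) xs ≡ take m xs ++ take n (drop m xs)
take-+ zero    n xs       = refl
take-+ (suc m) n []       = sym (take-[] n)
take-+ (suc m) n (x ∷ xs) = cong (x ∷_) (take-+ m n xs)

sum-⊆ : ∀ {xs ys : List ℕ} → xs ⊆ ys → sum xs ≤ sum ys
sum-⊆ []        = z≤n
sum-⊆ (y ∷ʳ τ)  = ≤-trans (sum-⊆ τ) (m≤n+m _ y)
sum-⊆ (refl ∷ τ) = +-monoʳ-≤ _ (sum-⊆ τ)

sum-take-mono : ∀ {m n} (xs : List ℕ) → m ≤ n → sum (take m xs) ≤ sum (take n xs)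
sum-take-mono xs m≤n = sum-⊆ (take⁺ m≤n)

length≤sum : ∀ {xs : List ℕ} → All (0 <_) xs → length xs ≤ sum xs
length≤sum []            = z≤n
length≤sum (0<x ∷ 0<xs) = +-mono-≤ 0<x (length≤sum 0<xs)

sum-take-∷ : ∀ {x xs} n → AllPairs _≥_ (x ∷ xs) → sum (take n xs) ≤ sum (take n (x ∷ xs))
sum-take-∷ zero    _                          = z≤n
sum-take-∷ {xs = []}     (suc n) _            = z≤n
sum-take-∷ {xs = y ∷ xs} (suc n) ((x≥y ∷ _) ∷ desc) = +-mono-≤ x≥y (sum-take-∷ n desc)

sum-take-++-[0] : ∀ n (xs : List ℕ) → sum (take n (xs ++ [ 0 ])) ≡ sum (take n xs)
sum-take-++-[0] zero          xs       = refl
sum-take-++-[0] (suc zero)    []       = refl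
sum-take-++-[0] (suc (suc n)) []       = refl
sum-take-++-[0] (suc n)       (x ∷ xs) = cong (x +_) (sum-take-++-[0] n xs)

sum≤sum-take : ∀ {S C : List ℕ} → AllPairs _≥_ C → S ⊆ C → sum S ≤ sum (take (length S) C)
sum≤sum-take _          []         = z≤n
sum≤sum-take {S} desc   (c ∷ʳ τ)   = ≤-trans (sum≤sum-take (AllPairs.tail desc) τ) (sum-take-∷ (length S) desc)
sum≤sum-take (_ ∷ desc) (refl ∷ τ) = +-monoʳ-≤ _ (sum≤sum-take desc τ)

-- Subset sums

SubsetSum : ℕ → List ℕ → ℕ → Set
SubsetSum d C x = ∃[ S ] (S ⊆ C × length S ≡ d × sum S ≡ x)

subsetSum-all : ∀ C → SubsetSum (length C) C (sum C)
subsetSum-all C = C , ⊆-refl , refl , refl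

subsetSum-∷ : ∀ c {d C x} → SubsetSum d C x → SubsetSum (suc d) (c ∷ C) (c + x)
subsetSum-∷ c (S , τ , refl , refl) = c ∷ S , refl ∷ τ , refl , refl

subsetSum-++ : ∀ {d e X Y x y} → SubsetSum d X x → SubsetSum e Y y → SubsetSum (d + e) (X ++ Y) (x + y)
subsetSum-++ (S , τ , refl , refl) (T , υ , refl , refl) = S ++ T , ++⁺ τ υ , length-++ S , sum-++ S T

subsetSum-mono : ∀ {d C D x} → C ⊆ D → SubsetSum d C x → SubsetSum d D x
subsetSum-mono υ (S , τ , l , s) = S , ⊆-trans τ υ , l , s

subsetSum-resp-↭ : ∀ {d C D x} → C ↭ D → SubsetSum d C x → SubsetSum d D x
subsetSum-resp-↭ σ (S , τ , refl , refl) with sublist-resp-↭ σ τ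
... | S′ , τ′ , ρ = S′ , τ′ , ↭-length ρ , sum-↭ ρ

subsetSum≥size : ∀ {d C x} → All (0 <_) C → SubsetSum d C x → d ≤ x
subsetSum≥size 0<C (S , τ , refl , refl) = length≤sum (All-resp-⊆ τ 0<C)

subsetSum≤sum-take : ∀ {d C x} → AllPairs _≥_ C → SubsetSum d C x → x ≤ sum (take d C)
subsetSum≤sum-take desc (S , τ , refl , refl) = sum≤sum-take desc τ

∈-subsets⁺ : ∀ {S A : List ℕ} → S ⊆ A → S ∈ subsets A
∈-subsets⁺ []                          = here refl
∈-subsets⁺ {A = x ∷ A} (.x ∷ʳ τ)       = ∈-++⁺ˡ (∈-subsets⁺ τ)
∈-subsets⁺ {A = x ∷ A} (refl ∷ τ)      = ∈-++⁺ʳ (subsets A) (∈-map⁺ (x ∷_) (∈-subsets⁺ τ))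

∈-subsets⁻ : ∀ {S} (A : List ℕ) → S ∈ subsets A → S ⊆ A
∈-subsets⁻ []      (here refl) = []
∈-subsets⁻ (x ∷ A) S∈ with ∈-++⁻ (subsets A) S∈
... | inj₁ S∈A = x ∷ʳ ∈-subsets⁻ A S∈A
... | inj₂ S∈xA with ∈-map⁻ (x ∷_) S∈xA
...   | _ , S∈A , refl = refl ∷ ∈-subsets⁻ A S∈A

∈-restrictedSums⁺ : ∀ {h A x} → SubsetSum h A x → x ∈ restrictedSums h A
∈-restrictedSums⁺ {h} (S , τ , l , refl) = ∈-map⁺ sum (∈-filter⁺ (λ S → length S ≟ h) (∈-subsets⁺ τ) l)

∈-restrictedSums⁻ : ∀ {h} A {x} → x ∈ restrictedSums h A → SubsetSum h A x
∈-restrictedSums⁻ {h} A x∈ with ∈-map⁻ sum x∈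
... | S , S∈ , refl with ∈-filter⁻ (λ S → length S ≟ h) {xs = subsets A} S∈
...   | S∈A , l = S , ∈-subsets⁻ A S∈A , l , refl

∈-HSums⁺ : ∀ {H A x} → Any (λ h → SubsetSum h A x) H → x ∈ HSums H A
∈-HSums⁺ = ∈-concat⁺ ∘ Any.map⁺ ∘ Any.map ∈-restrictedSums⁺

∈-HSums⁻ : ∀ H A {x} → x ∈ HSums H A → Any (λ h → SubsetSum h A x) H
∈-HSums⁻ H A x∈ = Any.map (∈-restrictedSums⁻ A) (Any.map⁻ (∈-concat⁻ (map (λ h → restrictedSums h A) H) x∈))

card-HSums-≥ : ∀ H A {L} → Unique L → All (_∈ HSums H A) L → length L ≤ card-HSums H A
card-HSums-≥ H A uL L⊆ = Unique-length-≤ (deduplicate _≟_ (HSums H A)) uL (All.map (∈-deduplicate⁺ _≟_) L⊆)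

card-HSums-≤ : ∀ H A n → All (_≤ n) (HSums H A) → card-HSums H A ≤ suc n
card-HSums-≤ H A n sums≤n = subst (card-HSums H A ≤_) (length-upTo (suc n))
  (Unique-length-≤ (upTo (suc n)) (deduplicate-! _≟_ (HSums H A))
    (All.tabulate λ x∈ → ∈-upTo⁺ (s≤s (All.lookup sums≤n (∈-deduplicate⁻ _≟_ (HSums H A) x∈)))))

-- Counting distinct d-sums of a strictly decreasing list

sumsExceptOne : List ℕ → List ℕ
sumsExceptOne []      = []
sumsExceptOne (t ∷ T) = sum T ∷ map (t +_) (sumsExceptOne T)

length-sumsExceptOne : ∀ T → length (sumsExceptOne T) ≡ length T
length-sumsExceptOne []      = refl
length-sumsExceptOne (t ∷ T) = cong suc (≡.trans (length-map (t +_) (sumsExceptOne T)) (length-sumsExceptOne T))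

sumsExceptOne-increasing : ∀ {T} → Linked _>_ T → Linked _<_ (sumsExceptOne T)
sumsExceptOne-increasing Linked.[]  = Linked.[]
sumsExceptOne-increasing [-]        = [-]
sumsExceptOne-increasing {t ∷ t′ ∷ T} (t>t′ ∷ desc) =
  +-monoˡ-< (sum T) t>t′ ∷ Linked.map⁺ (Linked.map (+-monoʳ-< t) (sumsExceptOne-increasing desc))

sumsExceptOne-subsetSums : ∀ c T → All (SubsetSum (length T) (c ∷ T)) (map (c +_) (sumsExceptOne T))
sumsExceptOne-subsetSums c []      = []
sumsExceptOne-subsetSums c (t ∷ T) =
  (c ∷ T , refl ∷ t ∷ʳ ⊆-refl , refl , refl) ∷ All.map⁺ (All.map (subsetSum-∷ c) (sumsExceptOne-subsetSums t T))

sumsExceptOne-above : ∀ c T → Linked _>_ (c ∷ T) → All (sum T <_) (map (c +_) (sumsExceptOne T))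
sumsExceptOne-above c []      _            = []
sumsExceptOne-above c (t ∷ T) (c>t ∷ desc) with Linked.Linked⇒AllPairs <-trans (sumsExceptOne-increasing desc)
... | sumT<rest ∷ _ = All.map⁺ (+-monoˡ-< (sum T) c>t ∷ All.map (λ sumT<y → +-mono-< c>t sumT<y) sumT<rest)

sumsExceptOne-unique : ∀ {T} → Linked _>_ T → Unique (sumsExceptOne T)
sumsExceptOne-unique desc = AllPairs.map <⇒≢ (Linked.Linked⇒AllPairs <-trans (sumsExceptOne-increasing desc))

distinctSubsetSums : ∀ C d → AllPairs _>_ C → d ≤ length C →
                     ∃[ L ] (Unique L × All (SubsetSum d C) L × d * (length C ∸ d) + 1 ≤ length L)
distinctSubsetSums []      zero _    _  = [ 0 ] , [] ∷ [] , subsetSum-all [] ∷ [] , ≤-refl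
distinctSubsetSums (c ∷ C) d    desc d≤ with d ≤? length C
... | no d≰C with ≤-antisym d≤ (≰⇒> d≰C)
...   | refl = [ sum (c ∷ C) ] , [] ∷ [] , subsetSum-all (c ∷ C) ∷ [] ,
               ≤-reflexive (≡.trans (cong (λ e → d * e + 1) (n∸n≡0 (length C))) (cong (_+ 1) (*-zeroʳ d)))
distinctSubsetSums (c ∷ C) d desc d≤ | yes d≤C with distinctSubsetSums C d (AllPairs.tail desc) d≤C
... | L , uL , sumsL , countL =
  L ++ new , unique , All.++⁺ (All.map (subsetSum-mono (c ∷ʳ ⊆-refl)) sumsL) sumsNew , count
  where
  T = take d C
  new = map (c +_) (sumsExceptOne T)

  length-T : length T ≡ d
  length-T = ≡.trans (length-take d C) (m≤n⇒m⊓n≡m d≤C)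

  descT : Linked _>_ (c ∷ T)
  descT = Linked.AllPairs⇒Linked (AllPairs.take⁺ (suc d) desc)

  unique : Unique (L ++ new)
  unique = Unique-++-separated (sum T) uL
    (Unique.map⁺ (+-cancelˡ-≡ c _ _) (sumsExceptOne-unique (Linked.tail descT)))
    (All.map (subsetSum≤sum-take (AllPairs.map <⇒≤ (AllPairs.tail desc))) sumsL)
    (sumsExceptOne-above c T descT)

  length-new : length new ≡ d
  length-new = ≡.trans (length-map (c +_) (sumsExceptOne T)) (≡.trans (length-sumsExceptOne T) length-T)

  sumsNew : All (SubsetSum d (c ∷ C)) new
  sumsNew = All.map (λ s → subst (λ e → SubsetSum e (c ∷ C) _) length-T (subsetSum-mono (refl ∷ take-⊆ d C) s))
                    (sumsExceptOne-subsetSums c T)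

  open ≤-Reasoning
  count : d * (suc (length C) ∸ d) + 1 ≤ length (L ++ new)
  count = begin
    d * (suc (length C) ∸ d) + 1 ≡⟨ cong (λ e → d * e + 1) (+-∸-assoc 1 d≤C) ⟩
    d * suc (length C ∸ d) + 1   ≡⟨ cong (_+ 1) (*-suc d (length C ∸ d)) ⟩
    d + d * (length C ∸ d) + 1   ≡⟨ +-assoc d _ 1 ⟩
    d + (d * (length C ∸ d) + 1) ≤⟨ +-monoʳ-≤ d countL ⟩
    d + length L                 ≡⟨ +-comm d (length L) ⟩
    length L + d                 ≡⟨ cong (length L +_) length-new ⟨
    length L + length new        ≡⟨ length-++ L ⟨
    length (L ++ new)            ∎

-- Disjoint blocks of h-sums

blockSums : ∀ {B} p h → AllPairs _>_ B → All (0 <_) B → p < h → h ≤ length B →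
            ∃[ L ] (Unique L × All (SubsetSum h B) L × All (sum (take p B) <_) L ×
                    All (_≤ sum (take h B)) L × (h ∸ p) * (length B ∸ h) + 1 ≤ length L)
blockSums {B} p h desc pos p<h h≤B
  with distinctSubsetSums (drop p B) (h ∸ p) (AllPairs.drop⁺ p desc)
         (subst (h ∸ p ≤_) (sym (length-drop p B)) (∸-monoˡ-≤ p h≤B))
... | L , uL , sumsL , countL =
  map (top +_) L , Unique.map⁺ (+-cancelˡ-≡ top _ _) uL ,
  All.map⁺ (All.map sumsB sumsL) , All.map⁺ (All.map above sumsL) , All.map⁺ (All.map below sumsL) , count
  where
  top = sum (take p B)
  d = h ∸ p

  p+d≡h : p + d ≡ h
  p+d≡h = m+[n∸m]≡n (<⇒≤ p<h)

  length-top : length (take p B) ≡ p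
  length-top = ≡.trans (length-take p B) (m≤n⇒m⊓n≡m (≤-trans (<⇒≤ p<h) h≤B))

  lengths : length (drop p B) ∸ d ≡ length B ∸ h
  lengths = begin
    length (drop p B) ∸ d ≡⟨ cong (_∸ d) (length-drop p B) ⟩
    length B ∸ p ∸ d      ≡⟨ ∸-+-assoc (length B) p d ⟩
    length B ∸ (p + d)    ≡⟨ cong (length B ∸_) p+d≡h ⟩
    length B ∸ h          ∎
    where open ≡-Reasoning

  count : d * (length B ∸ h) + 1 ≤ length (map (top +_) L)
  count = begin
    d * (length B ∸ h) + 1          ≡⟨ cong (λ e → d * e + 1) lengths ⟨
    d * (length (drop p B) ∸ d) + 1 ≤⟨ countL ⟩
    length L                        ≡⟨ length-map (top +_) L ⟨
    length (map (top +_) L)         ∎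
    where open ≤-Reasoning

  sumsB : ∀ {x} → SubsetSum d (drop p B) x → SubsetSum h B (top + x)
  sumsB s = subst₂ (λ e X → SubsetSum e X (top + _)) (≡.trans (cong (_+ d) length-top) p+d≡h) (take++drop≡id p B)
                   (subsetSum-++ (subsetSum-all (take p B)) s)

  above : ∀ {x} → SubsetSum d (drop p B) x → top < top + x
  above s = m<m+n top (≤-trans (m<n⇒0<n∸m p<h) (subsetSum≥size (All.drop⁺ p pos) s))

  below : ∀ {x} → SubsetSum d (drop p B) x → top + x ≤ sum (take h B)
  below {x} s = begin
    top + x
      ≤⟨ +-monoʳ-≤ top (subsetSum≤sum-take (AllPairs.map <⇒≤ (AllPairs.drop⁺ p desc)) s) ⟩
    top + sum (take d (drop p B))           ≡⟨ sum-++ (take p B) _ ⟨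
    sum (take p B ++ take d (drop p B))     ≡⟨ cong sum (take-+ p d B) ⟨
    sum (take (p + d) B)                    ≡⟨ cong (λ e → sum (take e B)) p+d≡h ⟩
    sum (take h B)                          ∎
    where open ≤-Reasoning

suc-∸-∸-1 : ∀ m h → suc m ∸ h ∸ 1 ≡ m ∸ h
suc-∸-∸-1 m h = ≡.trans (∸-+-assoc (suc m) h 1) (cong (suc m ∸_) (+-comm h 1))

chainSums : ∀ {B} p hs → AllPairs _>_ B → All (0 <_) B → Linked _<_ (p ∷ hs) → All (_≤ length B) hs →
            ∃[ L ] (Unique L × All (λ x → Any (λ h → SubsetSum h B x) hs) L × All (sum (take p B) <_) L ×
                    stepSum (suc (length B)) p hs + length hs ≤ length L)
chainSums p []       _    _   _            _           = [] , [] , [] , [] , z≤n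
chainSums {B} p (h ∷ hs) desc pos (p<h ∷ increasing) (h≤B ∷ hs≤B)
  with blockSums p h desc pos p<h h≤B | chainSums h hs desc pos increasing hs≤B
... | L₁ , u₁ , sums₁ , above₁ , below₁ , count₁ | L₂ , u₂ , sums₂ , above₂ , count₂ =
  L₁ ++ L₂ , Unique-++-separated (sum (take h B)) u₁ u₂ below₁ above₂ ,
  All.++⁺ (All.map here sums₁) (All.map there sums₂) ,
  All.++⁺ above₁ (All.map (≤-<-trans (sum-take-mono B (<⇒≤ p<h))) above₂) ,
  count
  where
  m = length B
  s = stepSum (suc m) h hs
  open ≤-Reasoning
  count : (h ∸ p) * (suc m ∸ h ∸ 1) + s + suc (length hs) ≤ length (L₁ ++ L₂)
  count = begin
    (h ∸ p) * (suc m ∸ h ∸ 1) + s + suc (length hs)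
      ≡⟨ cong (λ e → (h ∸ p) * e + s + suc (length hs)) (suc-∸-∸-1 m h) ⟩
    (h ∸ p) * (m ∸ h) + s + suc (length hs)           ≡⟨ regroup ((h ∸ p) * (m ∸ h)) s (length hs) ⟩
    ((h ∸ p) * (m ∸ h) + 1) + (s + length hs)         ≤⟨ +-mono-≤ count₁ count₂ ⟩
    length L₁ + length L₂                             ≡⟨ length-++ L₁ ⟨
    length (L₁ ++ L₂)                                 ∎
    where
    regroup : ∀ a b c → a + b + suc c ≡ (a + 1) + (b + c)
    regroup = solve-∀

AllPairs->-++-[0] : ∀ {B} → AllPairs _>_ B → All (0 <_) B → AllPairs _>_ (B ++ [ 0 ])
AllPairs->-++-[0] desc pos = AllPairs.++⁺ desc ([] ∷ []) (All.map (_∷ []) pos)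

lowerBoundSums : ∀ {B} h₁ hs → AllPairs _>_ B → All (0 <_) B →
                 Linked _<_ (h₁ ∷ hs) → All (_≤ length B) (h₁ ∷ hs) →
                 ∃[ L ] (Unique L × All (λ x → Any (λ h → SubsetSum h (B ++ [ 0 ]) x) (h₁ ∷ hs)) L ×
                         bound (suc (length B)) (h₁ ∷ hs) ≤ length L)
lowerBoundSums {B} h₁ hs desc pos increasing (h₁≤B ∷ hs≤B)
  with distinctSubsetSums (B ++ [ 0 ]) h₁ (AllPairs->-++-[0] desc pos)
         (subst (h₁ ≤_) (sym (length-++-comm B [ 0 ])) (m≤n⇒m≤1+n h₁≤B))
     | chainSums h₁ hs desc pos increasing hs≤B
... | L₀ , u₀ , sums₀ , count₀ | L , u , sums , above , count =
  L₀ ++ L , Unique-++-separated (sum (take h₁ B)) u₀ u below₀ above ,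
  All.++⁺ (All.map here sums₀) (All.map (there ∘ Any.map (subsetSum-mono (++⁺ʳ [ 0 ] ⊆-refl))) sums) ,
  total
  where
  m = length B
  s = stepSum (suc m) h₁ hs

  below₀ : All (_≤ sum (take h₁ B)) L₀
  below₀ = All.map (λ x → subst (_ ≤_) (sum-take-++-[0] h₁ B)
                            (subsetSum≤sum-take (AllPairs.map <⇒≤ (AllPairs->-++-[0] desc pos)) x)) sums₀

  open ≤-Reasoning
  total : h₁ * (suc m ∸ h₁ ∸ 1) + s + h₁ + suc (length hs) ≤ length (L₀ ++ L)
  total = begin
    h₁ * (suc m ∸ h₁ ∸ 1) + s + h₁ + suc (length hs)
      ≡⟨ cong (λ e → h₁ * e + s + h₁ + suc (length hs)) (suc-∸-∸-1 m h₁) ⟩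
    h₁ * (m ∸ h₁) + s + h₁ + suc (length hs)
      ≡⟨ regroup h₁ (m ∸ h₁) s (length hs) ⟩
    (h₁ * suc (m ∸ h₁) + 1) + (s + length hs)
      ≡⟨ cong (λ e → h₁ * e + 1 + (s + length hs)) (+-∸-assoc 1 h₁≤B) ⟨
    (h₁ * (suc m ∸ h₁) + 1) + (s + length hs)
      ≡⟨ cong (λ e → h₁ * (e ∸ h₁) + 1 + (s + length hs)) (length-++-comm B [ 0 ]) ⟨
    (h₁ * (length (B ++ [ 0 ]) ∸ h₁) + 1) + (s + length hs)
      ≤⟨ +-mono-≤ count₀ count ⟩
    length L₀ + length L
      ≡⟨ length-++ L₀ ⟨
    length (L₀ ++ L)
      ∎
    where
    regroup : ∀ h e t l → h * e + t + h + suc l ≡ (h * suc e + 1) + (t + l)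
    regroup = solve-∀

descendingArrangement : ∀ {A} → Unique A → 0 ∈ A → ∃[ B ] (AllPairs _>_ B × All (0 <_) B × B ++ [ 0 ] ↭ A)
descendingArrangement uA 0∈A with ∈-∃++ 0∈A
... | ys , zs , refl with Unique-resp-↭ (shift 0 ys zs) uA
...   | 0∉ ∷ u = sort (ys ++ zs) , desc , pos , arrangement
  where
  σ : sort (ys ++ zs) ↭ ys ++ zs
  σ = sort-↭ (ys ++ zs)

  desc : AllPairs _>_ (sort (ys ++ zs))
  desc = AllPairs.zipWith (λ (x≥y , x≢y) → ≤∧≢⇒< x≥y (x≢y ∘ sym))
           (Linked.Linked⇒AllPairs (λ x≥y y≥z → ≤-trans y≥z x≥y) (sort-↗ (ys ++ zs)) , Unique-resp-↭ (↭-sym σ) u)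

  pos : All (0 <_) (sort (ys ++ zs))
  pos = All-resp-↭ (↭-sym σ) (All.map (λ 0≢x → n≢0⇒n>0 (0≢x ∘ sym)) 0∉)

  arrangement : sort (ys ++ zs) ++ [ 0 ] ↭ ys ++ [ 0 ] ++ zs
  arrangement = trans (↭-sym (∷↭∷ʳ 0 _)) (trans (prep 0 σ) (↭-sym (shift 0 ys zs)))

card-HSums-lowerBound : (A : List ℕ) → Unique A → 0 ∈ A →
                        (h₁ : ℕ) (hs : List ℕ) → 1 ≤ h₁ → Linked _<_ (h₁ ∷ hs) →
                        All (λ h → h ≤ length A ∸ 1) (h₁ ∷ hs) →
                        bound (length A) (h₁ ∷ hs) ≤ card-HSums (h₁ ∷ hs) A
card-HSums-lowerBound A uA 0∈A h₁ hs _ increasing H≤ with descendingArrangement uA 0∈A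
... | B , desc , pos , σ =
  let length-A = ≡.trans (sym (↭-length σ)) (length-++-comm B [ 0 ])
      L , u , sums , count = lowerBoundSums h₁ hs desc pos increasing
                               (All.map (subst (_ ≤_) (cong (_∸ 1) length-A)) H≤)
  in subst (λ k → bound k (h₁ ∷ hs) ≤ card-HSums (h₁ ∷ hs) A) (sym length-A)
       (≤-trans count (card-HSums-≥ (h₁ ∷ hs) A u (All.map (∈-HSums⁺ ∘ Any.map (subsetSum-resp-↭ σ)) sums)))

-- The extremal case A = [0, k − 1], H = [1, r]

subsetSum-upTo≤ : ∀ {d k x} → SubsetSum d (upTo k) x → x ≤ sum (take d (downFrom k))
subsetSum-upTo≤ {k = k} s = subsetSum≤sum-take descending (subsetSum-resp-↭ upTo↭downFrom s)
  where
  upTo↭downFrom : upTo k ↭ downFrom k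
  upTo↭downFrom = subst (upTo k ↭_) (reverse-upTo k) (↭-sym (↭-reverse (upTo k)))
  descending : AllPairs _≥_ (downFrom k)
  descending = AllPairs.applyDownFrom⁺₁ (λ i → i) k (λ j<i _ → <⇒≤ j<i)

stepSum-map-suc : ∀ k p hs → stepSum (suc k) (suc p) (map suc hs) ≡ stepSum k p hs
stepSum-map-suc k p []       = refl
stepSum-map-suc k p (h ∷ hs) = cong ((h ∸ p) * (k ∸ h ∸ 1) +_) (stepSum-map-suc k h hs)

stepSum-consecutive : ∀ {k} r → r < k → stepSum k 0 (applyUpTo suc r) + r ≡ sum (take r (downFrom k))
stepSum-consecutive zero _ = refl
stepSum-consecutive {suc zero}    (suc r) (s≤s ())
stepSum-consecutive {suc (suc k)} (suc r) (s≤s r<k) = begin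
  1 * k + stepSum (suc (suc k)) 1 (applyUpTo (suc ∘ suc) r) + suc r
    ≡⟨ cong (λ e → 1 * k + e + suc r) shifted ⟩
  1 * k + stepSum (suc k) 0 (applyUpTo suc r) + suc r
    ≡⟨ regroup k (stepSum (suc k) 0 (applyUpTo suc r)) r ⟩
  suc k + (stepSum (suc k) 0 (applyUpTo suc r) + r)
    ≡⟨ cong (suc k +_) (stepSum-consecutive r r<k) ⟩
  suc k + sum (take r (downFrom (suc k)))
    ∎
  where
  open ≡-Reasoning
  shifted : stepSum (suc (suc k)) 1 (applyUpTo (suc ∘ suc) r) ≡ stepSum (suc k) 0 (applyUpTo suc r)
  shifted = ≡.trans (cong (stepSum (suc (suc k)) 1) (sym (map-applyUpTo suc suc r)))
                    (stepSum-map-suc (suc k) 0 (applyUpTo suc r))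
  regroup : ∀ k t r → 1 * k + t + suc r ≡ suc k + (t + r)
  regroup = solve-∀

bound-consecutive : ∀ {k} r → suc r < k → bound k (map suc (upTo (suc r))) ≡ suc (sum (take (suc r) (downFrom k)))
bound-consecutive {k} r r<k = begin
  stepSum k 0 H + 1 + length H
    ≡⟨ cong (_+ length H) (+-comm (stepSum k 0 H) 1) ⟩
  suc (stepSum k 0 H + length H)
    ≡⟨ cong₂ (λ X n → suc (stepSum k 0 X + n)) (map-upTo suc (suc r)) length-H ⟩
  suc (stepSum k 0 (applyUpTo suc (suc r)) + suc r)
    ≡⟨ cong suc (stepSum-consecutive (suc r) r<k) ⟩
  suc (sum (take (suc r) (downFrom k)))
    ∎
  where
  open ≡-Reasoning
  H = map suc (upTo (suc r))
  length-H : length H ≡ suc r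
  length-H = ≡.trans (length-map suc (upTo (suc r))) (length-upTo (suc r))

card-HSums-consecutive : (k r : ℕ) → 1 ≤ k → 1 ≤ r → r ≤ k ∸ 1 →
                         card-HSums (map suc (upTo r)) (upTo k) ≡ bound k (map suc (upTo r))
card-HSums-consecutive (suc k) (suc r) _ _ r≤k = ≤-antisym upper lower
  where
  H = map suc (upTo (suc r))
  N = sum (take (suc r) (downFrom (suc k)))

  H≤ : All (_≤ suc r) H
  H≤ = All.map⁺ (All.tabulate ∈-upTo⁻)

  increasing : Linked _<_ H
  increasing = subst (Linked _<_) (sym (map-upTo suc (suc r))) (Linked.applyUpTo⁺₂ suc (suc r) (λ i → n<1+n (suc i)))

  lower : bound (suc k) H ≤ card-HSums H (upTo (suc k))
  lower = subst (λ n → bound n H ≤ card-HSums H (upTo (suc k))) (length-upTo (suc k))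
    (card-HSums-lowerBound (upTo (suc k)) (Unique.upTo⁺ (suc k)) (∈-upTo⁺ (s≤s z≤n)) 1 _ (s≤s z≤n) increasing
      (All.map (λ {h} h≤r → subst (λ n → h ≤ n ∸ 1) (sym (length-upTo (suc k))) (≤-trans h≤r r≤k)) H≤))

  sums≤N : All (_≤ N) (HSums H (upTo (suc k)))
  sums≤N = All.tabulate λ x∈ →
    let h , h∈H , s = find (∈-HSums⁻ H (upTo (suc k)) x∈)
    in ≤-trans (subsetSum-upTo≤ s) (sum-take-mono (downFrom (suc k)) (All.lookup H≤ h∈H))

  upper : card-HSums H (upTo (suc k)) ≤ bound (suc k) H
  upper = subst (card-HSums H (upTo (suc k)) ≤_) (sym (bound-consecutive r (s≤s r≤k)))
                (card-HSums-≤ H (upTo (suc k)) N sums≤N)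

corollary7 : ((A : List ℕ) → Unique A → 0 ∈ A →
    (h₁ : ℕ) (hs : List ℕ) → 1 ≤ h₁ → Linked _<_ (h₁ ∷ hs) →
    All (λ h → h ≤ length A ∸ 1) (h₁ ∷ hs) →
    bound (length A) (h₁ ∷ hs) ≤ card-HSums (h₁ ∷ hs) A)
    ×
    ((k r : ℕ) → 1 ≤ k → 1 ≤ r → r ≤ k ∸ 1 →
    card-HSums (map suc (upTo r)) (upTo k) ≡ bound k (map suc (upTo r)))
corollary7 = card-HSums-lowerBound , card-HSums-consecutive
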